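{- Let $\mathbf{S}$ be a set equipped with a binary relation $\leq$, total binary operations $\land$ and $\mid$ on $\mathbf{S}$, and an element $\mathsf{U}\in\mathbf{S}$, satisfying: (1) $\leq$ is a preorder; (2) $A\leq \mathsf{U}$ for all $A$; (3) $A\land B\leq B\land A$ for all $A,B$; (4) $A\land B\leq A$ and $A\land B\leq B$ for all $A,B$; (5) if $C\leq A$ and $C\leq B$ then $C\leq A\land B$; (6) $A\mid B\leq B\mid A$ for all $A,B$; (7) $A\leq B$ implies $A\mid C\leq B\mid C$ for all $A,B,C$; (8) $A\mid\mathsf{U}\leq A$ for all $A$; (9) $A\leq A\mid A$ for all $A$. Then for all $A,B,C\in\mathbf{S}$ we have $(A\mid B)\mid C\leq A\mid(B\mid C)$.
   Context: $\land$ is called conjunction, $\mid$ parallel composition, $\leq$ refinement, and $\mathsf{U}$ the universal specification. -}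

module Defs where

open import Level using (Level; _⊔_; suc)
open import Relation.Binary.Structures using (IsPreorder)
open import Relation.Binary.PropositionalEquality using (_≡_)

record SpecAlgebra (c ℓ : Level) : Set (suc (c ⊔ ℓ)) where
  infix  4 _≤_
  infixr 7 _∧_
  infixr 6 _∣_
  field
    S   : Set c
    _≤_ : S → S → Set ℓ
    _∧_ : S → S → S
    _∣_ : S → S → S
    U   : S
    isPreorder : IsPreorder _≡_ _≤_
    ≤-U    : ∀ A → A ≤ U
    ∧-comm : ∀ A B → A ∧ B ≤ B ∧ A
    ∧-≤ˡ   : ∀ A B → A ∧ B ≤ A
    ∧-≤ʳ   : ∀ A B → A ∧ B ≤ B
    ∧-glb  : ∀ {A B C} → C ≤ A → C ≤ B → C ≤ A ∧ B
    ∣-comm : ∀ A B → A ∣ B ≤ B ∣ A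
    ∣-monoˡ : ∀ {A B} C → A ≤ B → A ∣ C ≤ B ∣ C
    ∣-U    : ∀ A → A ∣ U ≤ A
    ≤-∣-dup : ∀ A → A ≤ A ∣ A

module Submission where

open import Defs
open import Relation.Binary.Structures using (IsPreorder)

-- Axioms (2) and (8) make A ∣ B a lower bound of A and of B, and axiom (9)
-- with monotonicity makes it the greatest one; so ∣ is a meet, and a meet is
-- associative up to ≤.

module SpecAlgebraProperties {c ℓ} (𝒮 : SpecAlgebra c ℓ) where

  open SpecAlgebra 𝒮
  open IsPreorder isPreorder using (trans)

  ∣-monoʳ : ∀ {A B} C → A ≤ B → C ∣ A ≤ C ∣ B
  ∣-monoʳ {A} {B} C A≤B = trans (∣-comm C A) (trans (∣-monoˡ C A≤B) (∣-comm B C))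

  ∣-mono : ∀ {A A′ B B′} → A ≤ A′ → B ≤ B′ → A ∣ B ≤ A′ ∣ B′
  ∣-mono {A′ = A′} {B} A≤A′ B≤B′ = trans (∣-monoˡ B A≤A′) (∣-monoʳ A′ B≤B′)

  ∣-≤ˡ : ∀ A B → A ∣ B ≤ A
  ∣-≤ˡ A B = trans (∣-monoʳ A (≤-U B)) (∣-U A)

  ∣-≤ʳ : ∀ A B → A ∣ B ≤ B
  ∣-≤ʳ A B = trans (∣-comm A B) (∣-≤ˡ B A)

  ∣-glb : ∀ {A B C} → C ≤ A → C ≤ B → C ≤ A ∣ B
  ∣-glb {C = C} C≤A C≤B = trans (≤-∣-dup C) (∣-mono C≤A C≤B)

  ∣-assoc : ∀ A B C → (A ∣ B) ∣ C ≤ A ∣ (B ∣ C)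
  ∣-assoc A B C = ∣-glb (trans (∣-≤ˡ (A ∣ B) C) (∣-≤ˡ A B))
                        (∣-glb (trans (∣-≤ˡ (A ∣ B) C) (∣-≤ʳ A B)) (∣-≤ʳ (A ∣ B) C))

theorem6 : ∀ {c ℓ} (𝒮 : SpecAlgebra c ℓ) → let open SpecAlgebra 𝒮 in
    ∀ A B C → (A ∣ B) ∣ C ≤ A ∣ (B ∣ C)
theorem6 𝒮 = SpecAlgebraProperties.∣-assoc 𝒮
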